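{- Let $k \geq 1$ and let $A_1,\dots,A_{2k-1}$ be (possibly empty) balanced parenthesis sequences inducing ordered matchings $M_1,\dots,M_{2k-1}$. Then $$(A_1(A_2(\cdots(A_{k-1}(A_k)A_{k+1})\cdots)A_{2k-2})A_{2k-1})$$ is a balanced parenthesis sequence. Let $M$ be the ordered matching it induces, and let $$t = \sum_{i=1}^k \max\big(r_<(M_i, K_3),\, r_<(M_{2k-i}, K_3)\big).$$ Then $$r_<(M, K_3) \leq r_<(NM_{k+t}, K_3),$$ where for a positive integer $q$, $NM_q$ denotes the ordered graph on $\{1,\dots,2q\}$ in which $\{i,j\}$ is an edge if and only if $i+j = 2q+1$.
   Context: An ordered graph on $n$ vertices is a graph whose vertex set is $\{1,\dots,n\}$ with its natural order; an ordered matching is one in which every vertex has degree exactly $1$ (the empty matching on $0$ vertices is allowed). A balanced parenthesis sequence is a finite string of symbols "(" and ")" that is correctly matched. A balanced parenthesis sequence of length $2m$ induces the ordered matching on $\{1,\dots,2m\}$ whose edges are the pairs $\{i,j\}$ such that the parenthesis in position $i$ is matched with the parenthesis in position $j$. A copy of an ordered graph $G$ on $\{1,\dots,m\}$ inside an edge-colored ordered complete graph on $\{1,\dots,N\}$ is an increasing map from $\{1,\dots,m\}$ to $\{1,\dots,N\}$ sending every edge of $G$ to an edge; it is red (resp. blue) if all image edges are red (resp. blue). For ordered graphs $G,H$, $r_<(G,H)$ is the smallest nonnegative integer $N$ such that every red/blue coloring of the edges of the ordered complete graph on $\{1,\dots,N\}$ contains a red copy of $G$ or a blue copy of $H$ (so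 the empty matching has $r_<=0$). $K_3$ is the triangle. -}

module Defs where

open import Data.Nat using (ℕ; zero; suc; _+_; _*_; _∸_; _≤_; _⊔_)
open import Data.Fin using (Fin; toℕ) renaming (_<_ to _<ᶠ_)
open import Data.List using (List; []; _∷_; _++_; length; drop; map; upTo)
open import Data.Nat.ListAction using (sum)
open import Data.Product using (Σ; _×_)
open import Data.Sum using (_⊎_)
open import Relation.Binary.PropositionalEquality using (_≡_; _≢_)

data Paren : Set where
  op : Paren
  cl : Paren

data Balanced : List Paren → Set where
  bal-[] : Balanced []
  bal-wrap : ∀ {A B} → Balanced A → Balanced B → Balanced (op ∷ A ++ cl ∷ B)

-- Ordered graphs on {0,…,size-1} (0-based version of {1,…,n}).
record OrderedGraph : Set₁ where
  field
    size : ℕ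
    adj  : Fin size → Fin size → Set
open OrderedGraph public

Matched : List Paren → ℕ → ℕ → Set
Matched s a b =
  Σ (List Paren) λ inner → Σ (List Paren) λ rest →
    (drop a s ≡ op ∷ inner ++ cl ∷ rest) × Balanced inner × (b ≡ a + suc (length inner))

inducedMatching : List Paren → OrderedGraph
inducedMatching s = record
  { size = length s
  ; adj  = λ i j → Matched s (toℕ i) (toℕ j) ⊎ Matched s (toℕ j) (toℕ i) }

K3 : OrderedGraph
K3 = record { size = 3 ; adj = λ i j → i ≢ j }

-- NM_q on {1,…,2q}: {i,j} edge iff i + j = 2q + 1 (here with 0-based vertices i-1, j-1).
NM : ℕ → OrderedGraph
NM q = record { size = 2 * q ; adj = λ i j → suc (toℕ i) + suc (toℕ j) ≡ 2 * q + 1 }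

-- Two-colourings of the edges of the ordered complete graph on N vertices
-- (only values c a b with a < b are used).
data Colour : Set where
  red blue : Colour

Colouring : ℕ → Set
Colouring N = Fin N → Fin N → Colour

CopyOf : (G : OrderedGraph) → {N : ℕ} → Colouring N → Colour → Set
CopyOf G {N} c col =
  Σ (Fin (size G) → Fin N) λ f →
    (∀ i j → i <ᶠ j → f i <ᶠ f j) ×
    (∀ i j → i <ᶠ j → adj G i j → c (f i) (f j) ≡ col)

Arrows : OrderedGraph → OrderedGraph → ℕ → Set
Arrows G H N = (c : Colouring N) → CopyOf G c red ⊎ CopyOf H c blue

IsOrdRamsey : OrderedGraph → OrderedGraph → ℕ → Set
IsOrdRamsey G H R = Arrows G H R × (∀ N → Arrows G H N → R ≤ N)

-- The nested sequence (A_1(A_2(⋯(A_{k-1}(A_k)A_{k+1})⋯)A_{2k-2})A_{2k-1}).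
-- nestAux k A m j = level j, with m more levels inside it (innermost is (A_k)).
nestAux : ℕ → (ℕ → List Paren) → ℕ → ℕ → List Paren
nestAux k A zero j = op ∷ A j ++ cl ∷ []
nestAux k A (suc m) j = op ∷ A j ++ nestAux k A m (suc j) ++ A (2 * k ∸ j) ++ cl ∷ []

nested : ℕ → (ℕ → List Paren) → List Paren
nested k A = nestAux k A (k ∸ 1) 1

tSum : ℕ → (ℕ → ℕ) → ℕ
tSum k r = sum (map (λ i → r (suc i) ⊔ r (2 * k ∸ suc i)) (upTo k))

module Submission where

-- Let M be the matching of (A₁(A₂(⋯(A_k)⋯)A_{2k-2})A_{2k-1}) and q = k + t.  Given any colouring
-- of K_R with R = r<(NM_q , K₃) and no blue triangle, there is a red copy of NM_q, i.e. 2q vertices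
-- whose symmetric pairs {x , 2q-1-x} are all red.  Level j of the nesting is placed on the pair
-- (lo , 2q-1-lo): its two parentheses go to the pair, A_j into the next max(r_j , r_{2k-j})
-- vertices after lo, its mirror A_{2k-j} into the same number of vertices before 2q-1-lo, and the
-- deeper levels in between.  Each block has at least r_i vertices, so it contains a red copy of
-- M_i (there is no blue triangle).  Hence R arrows (M , K₃); since arrowing is decidable on finite
-- colourings, the least such number exists and is ≤ R.

open import Defs
open import Data.Nat using (ℕ; zero; suc; _+_; _*_; _∸_; _≤_; _<_; _⊔_; z≤n; s≤s; _<?_)
open import Data.Nat.Properties
open import Data.Nat.ListAction using (sum)
open import Data.Nat.Tactic.RingSolver using (solve-∀)
open import Data.Fin using (Fin; toℕ; fromℕ<) renaming (zero to fzero; suc to fsuc; _<_ to _<ᶠ_)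
import Data.Fin.Properties as Fin
open import Data.List using (List; []; _∷_; _++_; length; drop; take; upTo; applyUpTo)
open import Data.List.Properties
  using (++-assoc; ++-identityʳ; length-++; length-drop; take++drop≡id; length-++-≤ˡ; length-++-sucʳ;
         ∷-injective; ∷-injectiveˡ; ∷-injectiveʳ; map-cong; map-upTo)
open import Data.Vec.Functional using (Vector; head; tail) renaming (_∷_ to _∷ᵛ_)
open import Data.Product using (Σ; _×_; _,_; proj₁; proj₂)
open import Data.Sum using (_⊎_; inj₁; inj₂)
open import Data.Empty using (⊥; ⊥-elim)
open import Relation.Nullary using (¬_; Dec; yes; no)
open import Relation.Nullary.Decidable using (_×-dec_; _⊎-dec_; _→-dec_; map′; ¬?)
open import Relation.Binary.PropositionalEquality

++-split : ∀ {A : Set} (U S V W : List A) → U ++ S ≡ V ++ W →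
  (Σ (List A) λ M → (U ≡ V ++ M) × (W ≡ M ++ S)) ⊎
  (Σ (List A) λ M → (V ≡ U ++ M) × (S ≡ M ++ W))
++-split [] S V W e = inj₂ (V , refl , e)
++-split (u ∷ U) S [] W e = inj₁ (u ∷ U , refl , sym e)
++-split (u ∷ U) S (v ∷ V) W e with ∷-injective e
... | refl , e′ with ++-split U S V W e′
... | inj₁ (M , p , q) = inj₁ (M , cong (u ∷_) p , q)
... | inj₂ (M , p , q) = inj₂ (M , cong (u ∷_) p , q)

drop-++ˡ : ∀ {A : Set} a (X Y : List A) → a ≤ length X → drop a (X ++ Y) ≡ drop a X ++ Y
drop-++ˡ zero X Y _ = refl
drop-++ˡ (suc a) (x ∷ X) Y (s≤s a≤) = drop-++ˡ a X Y a≤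

drop-++ʳ : ∀ {A : Set} a (X Y : List A) → length X ≤ a → drop a (X ++ Y) ≡ drop (a ∸ length X) Y
drop-++ʳ a [] Y _ = refl
drop-++ʳ (suc a) (x ∷ X) Y (s≤s ≤a) = drop-++ʳ a X Y ≤a

drop-position : ∀ {A : Set} a (s : List A) x → x < length (drop a s) → a + x < length s
drop-position zero s x x< = x<
drop-position (suc a) [] x ()
drop-position (suc a) (_ ∷ s) x x< = s≤s (drop-position a s x x<)

drop-factor : ∀ {A : Set} a (X : List A) {Z} → drop a X ≡ Z → X ≡ take a X ++ Z
drop-factor a X d = trans (sym (take++drop≡id a X)) (cong (take a X ++_) d)

opens closes : List Paren → ℕ
opens [] = 0
opens (op ∷ xs) = suc (opens xs)
opens (cl ∷ xs) = opens xs
closes [] = 0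
closes (op ∷ xs) = closes xs
closes (cl ∷ xs) = suc (closes xs)

opens-++ : ∀ X Y → opens (X ++ Y) ≡ opens X + opens Y
opens-++ [] Y = refl
opens-++ (op ∷ X) Y = cong suc (opens-++ X Y)
opens-++ (cl ∷ X) Y = opens-++ X Y

closes-++ : ∀ X Y → closes (X ++ Y) ≡ closes X + closes Y
closes-++ [] Y = refl
closes-++ (op ∷ X) Y = closes-++ X Y
closes-++ (cl ∷ X) Y = cong suc (closes-++ X Y)

balanced-counts : ∀ {X} → Balanced X → opens X ≡ closes X
balanced-counts bal-[] = refl
balanced-counts (bal-wrap {A} {B} bA bB) = begin
  suc (opens (A ++ cl ∷ B))     ≡⟨ cong suc (opens-++ A (cl ∷ B)) ⟩
  suc (opens A + opens B)       ≡⟨ cong₂ (λ u v → suc (u + v)) (balanced-counts bA) (balanced-counts bB) ⟩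
  suc (closes A + closes B)     ≡⟨ +-suc (closes A) (closes B) ⟨
  closes A + suc (closes B)     ≡⟨ closes-++ A (cl ∷ B) ⟨
  closes (A ++ cl ∷ B)          ∎
  where open ≡-Reasoning

balanced-prefix : ∀ {X} → Balanced X → ∀ P W → X ≡ P ++ W → closes P ≤ opens P
balanced-prefix _ [] W _ = z≤n
balanced-prefix bal-[] (_ ∷ _) W ()
balanced-prefix (bal-wrap {A} {B} bA bB) (op ∷ P) W e
  with ++-split P W A (cl ∷ B) (sym (∷-injectiveʳ e))
... | inj₂ (M , refl , _) = m≤n⇒m≤1+n (balanced-prefix bA P M refl)
... | inj₁ (M , refl , q) = through-close M q
  where
  through-close : ∀ M → cl ∷ B ≡ M ++ W → closes (A ++ M) ≤ suc (opens (A ++ M))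
  through-close [] _ = begin
    closes (A ++ [])    ≡⟨ cong closes (++-identityʳ A) ⟩
    closes A            ≡⟨ balanced-counts bA ⟨
    opens A             ≤⟨ n≤1+n _ ⟩
    suc (opens A)       ≡⟨ cong (λ Z → suc (opens Z)) (++-identityʳ A) ⟨
    suc (opens (A ++ [])) ∎
    where open ≤-Reasoning
  through-close (_ ∷ M) q with ∷-injective q
  ... | refl , q′ = begin
    closes (A ++ cl ∷ M)           ≡⟨ closes-++ A (cl ∷ M) ⟩
    closes A + suc (closes M)      ≡⟨ +-suc (closes A) (closes M) ⟩
    suc (closes A + closes M)      ≤⟨ s≤s (+-mono-≤ (≤-reflexive (sym (balanced-counts bA))) (balanced-prefix bB M W q′)) ⟩
    suc (opens A + opens M)        ≡⟨ cong suc (opens-++ A (cl ∷ M)) ⟨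
    suc (opens (A ++ cl ∷ M))      ∎
    where open ≤-Reasoning
balanced-prefix (bal-wrap _ _) (cl ∷ P) W ()

balanced-suffix : ∀ {X} → Balanced X → ∀ U S → X ≡ U ++ S → opens S ≤ closes S
balanced-suffix {X} bX U S e = +-cancelˡ-≤ (closes U) (opens S) (closes S) (begin
  closes U + opens S  ≤⟨ +-monoˡ-≤ (opens S) (balanced-prefix bX U S e) ⟩
  opens U + opens S   ≡⟨ opens-++ U S ⟨
  opens (U ++ S)      ≡⟨ cong opens e ⟨
  opens X             ≡⟨ balanced-counts bX ⟩
  closes X            ≡⟨ cong closes e ⟩
  closes (U ++ S)     ≡⟨ closes-++ U S ⟩
  closes U + closes S ∎)
  where open ≤-Reasoning

balanced-++ : ∀ {X Y} → Balanced X → Balanced Y → Balanced (X ++ Y)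
balanced-++ bal-[] bY = bY
balanced-++ {Y = Y} (bal-wrap {A} {B} bA bB) bY =
  subst Balanced (cong (op ∷_) (sym (++-assoc A (cl ∷ B) Y))) (bal-wrap bA (balanced-++ bB bY))

-- A suffix of a balanced sequence never consists of "(" followed by a prefix of a
-- balanced sequence: the former has surplus ")", the latter would have surplus "(".
no-open-suffix : ∀ {X I} → Balanced X → Balanced I → ∀ U P W →
  X ≡ U ++ op ∷ P → I ≡ P ++ W → ⊥
no-open-suffix bX bI U P W eX eI =
  <⇒≱ (s≤s (balanced-prefix bI P W eI)) (balanced-suffix bX U (op ∷ P) eX)

no-close-prefix : ∀ {X P} → Balanced X → Balanced P → ∀ M → X ≡ P ++ cl ∷ M → ⊥
no-close-prefix {X} {P} bX bP M e = <⇒≱ surplus (balanced-prefix bX (P ++ cl ∷ []) M e′)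
  where
  e′ : X ≡ (P ++ cl ∷ []) ++ M
  e′ = trans e (sym (++-assoc P (cl ∷ []) M))
  surplus : opens (P ++ cl ∷ []) < closes (P ++ cl ∷ [])
  surplus = begin-strict
    opens (P ++ cl ∷ [])    ≡⟨ opens-++ P (cl ∷ []) ⟩
    opens P + 0             ≡⟨ cong (_+ 0) (balanced-counts bP) ⟩
    closes P + 0            <⟨ +-monoʳ-< (closes P) (s≤s z≤n) ⟩
    closes P + 1            ≡⟨ closes-++ P (cl ∷ []) ⟨
    closes (P ++ cl ∷ [])   ∎
    where open ≤-Reasoning

balanced-before-close : ∀ {X X′} → Balanced X → Balanced X′ → ∀ Y Y′ →
  X ++ cl ∷ Y ≡ X′ ++ cl ∷ Y′ → X ≡ X′
balanced-before-close {X} {X′} bX bX′ Y Y′ e with ++-split X (cl ∷ Y) X′ (cl ∷ Y′) e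
... | inj₁ ([] , p , _) = trans p (++-identityʳ X′)
... | inj₁ (_ ∷ M , p , q) with ∷-injective q
...   | refl , _ = ⊥-elim (no-close-prefix bX bX′ M p)
balanced-before-close {X} {X′} bX bX′ Y Y′ e | inj₂ ([] , p , _) = sym (trans p (++-identityʳ X))
balanced-before-close {X} {X′} bX bX′ Y Y′ e | inj₂ (_ ∷ M , p , q) with ∷-injective q
...   | refl , _ = ⊥-elim (no-close-prefix bX′ bX M p)

matched-bounds : ∀ s a b → Matched s a b → (a < b) × (b < length s)
matched-bounds s a b (inner , rest , e , _ , refl) =
  m<m+n a (s≤s z≤n) , drop-position a s (suc (length inner)) inner-fits
  where
  inner-fits : suc (length inner) < length (drop a s)
  inner-fits = subst (suc (length inner) <_) (cong length (sym e))
    (s≤s (≤-trans (s≤s (length-++-≤ˡ inner)) (≤-reflexive (sym (length-++-sucʳ inner cl rest)))))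

matched-block-within : ∀ {X inner} → Balanced X → Balanced inner → ∀ a → a < length X →
  ∀ Y rest → drop a X ++ Y ≡ op ∷ inner ++ cl ∷ rest →
  Σ (List Paren) λ rest′ → drop a X ≡ op ∷ inner ++ cl ∷ rest′
matched-block-within {X} {inner} bX bI a a< Y rest e
  with ++-split (drop a X) Y (op ∷ inner) (cl ∷ rest) e
... | inj₁ ([] , p , _) =  -- drop a X would be "(" inner, a suffix with surplus "(".
  ⊥-elim (no-open-suffix bX bI (take a X) (inner ++ []) [] (drop-factor a X p)
           (sym (trans (++-identityʳ (inner ++ [])) (++-identityʳ inner))))
... | inj₁ (_ ∷ M , p , q) with ∷-injective q
...   | refl , _ = M , p
matched-block-within {X} {inner} bX bI a a< Y rest e | inj₂ (S , p , _) = ⊥-elim (starts (drop a X) refl p)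
  where
  -- Otherwise drop a X is a prefix of "(" inner: empty (impossible as a < length X),
  -- or "(" followed by a prefix of inner (a suffix with surplus "(").
  starts : ∀ T → drop a X ≡ T → op ∷ inner ≡ T ++ S → ⊥
  starts [] d _ = <⇒≱ a< (m∸n≡0⇒m≤n (trans (sym (length-drop a X)) (cong length d)))
  starts (_ ∷ T) d q with ∷-injective q
  ... | refl , q′ = no-open-suffix bX bI (take a X) T S (drop-factor a X d) q′

matched-++ : ∀ {X} → Balanced X → ∀ Y a b → Matched (X ++ Y) a b →
  Matched X a b ⊎ ((length X ≤ a) × Matched Y (a ∸ length X) (b ∸ length X))
matched-++ {X} bX Y a b (inner , rest , e , bI , eb) with a <? length X
... | yes a< with matched-block-within bX bI a a< Y rest (trans (sym (drop-++ˡ a X Y (<⇒≤ a<))) e)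
...   | rest′ , e′ = inj₁ (inner , rest′ , e′ , bI , eb)
matched-++ {X} bX Y a b (inner , rest , e , bI , eb) | no a≮ =
  inj₂ (X≤a , inner , rest , trans (sym (drop-++ʳ a X Y X≤a)) e , bI ,
        trans (cong (_∸ length X) eb) (+-∸-comm (suc (length inner)) X≤a))
  where
  X≤a : length X ≤ a
  X≤a = ≮⇒≥ a≮

close-unmatched : ∀ a b → Matched (cl ∷ []) a b → ⊥
close-unmatched zero b (_ , _ , () , _)
close-unmatched (suc zero) b (_ , _ , () , _)
close-unmatched (suc (suc a)) b (_ , _ , () , _)

matched-wrap : ∀ {X} → Balanced X → ∀ a b → Matched (op ∷ X ++ cl ∷ []) a b →
  ((a ≡ 0) × (b ≡ suc (length X))) ⊎
  (Σ ℕ λ a′ → Σ ℕ λ b′ → (a ≡ suc a′) × (b ≡ suc b′) × Matched X a′ b′)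
matched-wrap {X} bX zero b (inner , rest , e , bI , refl) =
  inj₁ (refl , cong (λ Z → suc (length Z)) (sym (balanced-before-close bX bI [] rest (∷-injectiveʳ e))))
matched-wrap {X} bX (suc a) b (inner , rest , e , bI , refl)
  with matched-++ bX (cl ∷ []) a (a + suc (length inner)) (inner , rest , e , bI , refl)
... | inj₁ m = inj₂ (a , a + suc (length inner) , refl , refl , m)
... | inj₂ (_ , m) = ⊥-elim (close-unmatched _ _ m)

CloseSplit : List Paren → (List Paren → List Paren → Set) → Set
CloseSplit xs P = Σ (List Paren) λ A → Σ (List Paren) λ B → (xs ≡ A ++ cl ∷ B) × P A B

split-at-head? : ∀ x xs (P : List Paren → List Paren → Set) →
  (x ≡ cl → Dec (P [] xs)) → Dec ((x ≡ cl) × P [] xs)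
split-at-head? op xs P P? = no λ ()
split-at-head? cl xs P P? = map′ (refl ,_) proj₂ (P? refl)

close-split? : ∀ xs (P : List Paren → List Paren → Set) →
  (∀ A B → xs ≡ A ++ cl ∷ B → Dec (P A B)) → Dec (CloseSplit xs P)
close-split? [] P P? = no λ { ([] , _ , () , _) ; (_ ∷ _ , _ , () , _) }
close-split? (x ∷ xs) P P? =
  map′ from to (split-at-head? x xs P (λ x≡cl → P? [] xs (cong (_∷ xs) x≡cl)) ⊎-dec
                close-split? xs (λ A B → P (x ∷ A) B) (λ A B e → P? (x ∷ A) B (cong (x ∷_) e)))
  where
  from : (x ≡ cl) × P [] xs ⊎ CloseSplit xs (λ A B → P (x ∷ A) B) → CloseSplit (x ∷ xs) P
  from (inj₁ (x≡cl , p)) = [] , xs , cong (_∷ xs) x≡cl , p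
  from (inj₂ (A , B , e , p)) = x ∷ A , B , cong (x ∷_) e , p
  to : CloseSplit (x ∷ xs) P → (x ≡ cl) × P [] xs ⊎ CloseSplit xs (λ A B → P (x ∷ A) B)
  to ([] , B , e , p) = inj₁ (∷-injectiveˡ e , subst (P []) (sym (∷-injectiveʳ e)) p)
  to (y ∷ A , B , e , p) = inj₂ (A , B , ∷-injectiveʳ e , subst (λ z → P (z ∷ A) B) (sym (∷-injectiveˡ e)) p)

close-split-shorter : ∀ xs A B → xs ≡ A ++ cl ∷ B → (length A < length xs) × (length B < length xs)
close-split-shorter xs A B e rewrite e | length-++ A {cl ∷ B} =
  m<m+n (length A) (s≤s z≤n) , subst (length B <_) (sym (+-suc (length A) (length B))) (s≤s (m≤n+m (length B) (length A)))

balanced-bounded? : ∀ n xs → length xs ≤ n → Dec (Balanced xs)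
balanced-bounded? n [] _ = yes bal-[]
balanced-bounded? n (cl ∷ xs) _ = no λ ()
balanced-bounded? (suc n) (op ∷ xs) (s≤s xs≤n) =
  map′ (λ { (A , B , refl , bA , bB) → bal-wrap bA bB }) (λ { (bal-wrap {A} {B} bA bB) → A , B , refl , bA , bB })
    (close-split? xs (λ A B → Balanced A × Balanced B) λ A B e →
      balanced-bounded? n A (<⇒≤ (<-≤-trans (proj₁ (close-split-shorter xs A B e)) xs≤n)) ×-dec
      balanced-bounded? n B (<⇒≤ (<-≤-trans (proj₂ (close-split-shorter xs A B e)) xs≤n)))

balanced? : ∀ xs → Dec (Balanced xs)
balanced? xs = balanced-bounded? (length xs) xs ≤-refl

opening-block? : ∀ L (Q : List Paren → Set) → (∀ A → Dec (Q A)) →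
  Dec (Σ (List Paren) λ inner → Σ (List Paren) λ rest → (L ≡ op ∷ inner ++ cl ∷ rest) × Q inner)
opening-block? [] Q Q? = no λ { (_ , _ , () , _) }
opening-block? (cl ∷ L) Q Q? = no λ { (_ , _ , () , _) }
opening-block? (op ∷ L) Q Q? =
  map′ (λ { (A , B , e , q) → A , B , cong (op ∷_) e , q }) (λ { (A , B , e , q) → A , B , ∷-injectiveʳ e , q })
    (close-split? L (λ A B → Q A) (λ A B _ → Q? A))

matched? : ∀ s a b → Dec (Matched s a b)
matched? s a b = opening-block? (drop a s) _ λ A → balanced? A ×-dec (b ≟ a + suc (length A))

matching-adj? : ∀ s i j → Dec (adj (inducedMatching s) i j)
matching-adj? s i j = matched? s (toℕ i) (toℕ j) ⊎-dec matched? s (toℕ j) (toℕ i)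

K3-adj? : ∀ i j → Dec (adj K3 i j)
K3-adj? i j = ¬? (i Fin.≟ j)

Invariant : {A : Set} → (A → A → Set) → (A → Set) → Set
Invariant _≈_ P = ∀ {x y} → x ≈ y → P x → P y

Searchable : (A : Set) → (A → A → Set) → Set₁
Searchable A _≈_ = ∀ P → Invariant _≈_ P → (∀ x → Dec (P x)) → Dec (Σ A P)

Pointwise : ∀ {B : Set} n → (B → B → Set) → Vector B n → Vector B n → Set
Pointwise n _≈_ f g = ∀ i → f i ≈ g i

search-Fin : ∀ n → Searchable (Fin n) _≡_
search-Fin n P _ P? = Fin.any? P?

search-Colour : Searchable Colour _≡_
search-Colour P _ P? with P? red | P? blue
... | yes p | _ = yes (red , p)
... | no _ | yes p = yes (blue , p)
... | no ¬r | no ¬b = no λ { (red , p) → ¬r p ; (blue , p) → ¬b p }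

search-Vector : ∀ {B : Set} {_≈_ : B → B → Set} → (∀ b → b ≈ b) →
  Searchable B _≈_ → ∀ n → Searchable (Vector B n) (Pointwise n _≈_)
search-Vector ≈-refl search zero P inv P? with P? (λ ())
... | yes p = yes (_ , p)
... | no ¬p = no λ { (f , p) → ¬p (inv (λ ()) p) }
search-Vector {B} {_≈_} ≈-refl search (suc n) P inv P? =
  map′ (λ { (b , g , p) → b ∷ᵛ g , p }) (λ { (f , p) → head f , tail f , inv η p })
    (search WithHead WithHead-inv WithHead?)
  where
  WithHead : B → Set
  WithHead b = Σ (Vector B n) λ g → P (b ∷ᵛ g)
  WithHead? : ∀ b → Dec (WithHead b)
  WithHead? b = search-Vector ≈-refl search n (λ g → P (b ∷ᵛ g))
    (λ g≈g′ → inv λ { fzero → ≈-refl b ; (fsuc i) → g≈g′ i }) (λ g → P? (b ∷ᵛ g))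
  WithHead-inv : Invariant _≈_ WithHead
  WithHead-inv b≈b′ (g , p) = g , inv (λ { fzero → b≈b′ ; (fsuc i) → ≈-refl (g i) }) p
  η : ∀ {f} → Pointwise (suc n) _≈_ f (head f ∷ᵛ tail f)
  η {f} fzero = ≈-refl (f fzero)
  η {f} (fsuc i) = ≈-refl (f (fsuc i))

searchable-∀? : ∀ {A : Set} {_≈_ : A → A → Set} → Searchable A _≈_ → (∀ {x y} → x ≈ y → y ≈ x) →
  ∀ P → Invariant _≈_ P → (∀ x → Dec (P x)) → Dec (∀ x → P x)
searchable-∀? search ≈-sym P inv P?
  with search (λ x → ¬ P x) (λ x≈y ¬px py → ¬px (inv (≈-sym x≈y) py)) (λ x → ¬? (P? x))
... | yes (x , ¬px) = no λ all → ¬px (all x)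
... | no ¬counter = yes λ x → decided x (P? x)
  where
  decided : ∀ x → Dec (P x) → P x
  decided x (yes px) = px
  decided x (no ¬px) = ⊥-elim (¬counter (x , ¬px))

SameColouring : ∀ {N} → Colouring N → Colouring N → Set
SameColouring {N} = Pointwise N (Pointwise N _≡_)

search-Colouring : ∀ N → Searchable (Colouring N) SameColouring
search-Colouring N = search-Vector (λ b i → refl) (search-Vector (λ _ → refl) search-Colour N) N

colour? : (a b : Colour) → Dec (a ≡ b)
colour? red red = yes refl
colour? red blue = no λ ()
colour? blue red = no λ ()
colour? blue blue = yes refl

copy? : (G : OrderedGraph) → (∀ i j → Dec (adj G i j)) → ∀ {N} (c : Colouring N) col →
  Dec (CopyOf G c col)
copy? G adj? {N} c col = search-Vector (λ _ → refl) (search-Fin N) (size G) _ invariant λ f →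
  Fin.all? (λ i → Fin.all? λ j → i Fin.<? j →-dec f i Fin.<? f j) ×-dec
  Fin.all? (λ i → Fin.all? λ j → i Fin.<? j →-dec (adj? i j →-dec colour? (c (f i) (f j)) col))
  where
  invariant : Invariant (Pointwise (size G) _≡_) _
  invariant f≡g (increasing , edges) =
    (λ i j i<j → subst₂ _<ᶠ_ (f≡g i) (f≡g j) (increasing i j i<j)) ,
    (λ i j i<j ij → subst₂ (λ u v → c u v ≡ col) (f≡g i) (f≡g j) (edges i j i<j ij))

copy-transport : ∀ {G N} {c c′ : Colouring N} {col} → SameColouring c c′ → CopyOf G c col → CopyOf G c′ col
copy-transport c≡c′ (f , increasing , edges) =
  f , increasing , λ i j i<j ij → trans (sym (c≡c′ (f i) (f j))) (edges i j i<j ij)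

arrows? : (G H : OrderedGraph) → (∀ i j → Dec (adj G i j)) → (∀ i j → Dec (adj H i j)) →
  ∀ N → Dec (Arrows G H N)
arrows? G H G? H? N =
  searchable-∀? (search-Colouring N) (λ c≡c′ i j → sym (c≡c′ i j)) _ invariant
    (λ c → copy? G G? c red ⊎-dec copy? H H? c blue)
  where
  invariant : Invariant SameColouring (λ c → CopyOf G c red ⊎ CopyOf H c blue)
  invariant c≡c′ (inj₁ copy) = inj₁ (copy-transport c≡c′ copy)
  invariant c≡c′ (inj₂ copy) = inj₂ (copy-transport c≡c′ copy)

Least : (ℕ → Set) → ℕ → ℕ → Set
Least P n N = P N × (∀ N′ → P N′ → N ≤ N′) × N ≤ n

least-upto : (P : ℕ → Set) → (∀ n → Dec (P n)) → ∀ n →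
  (Σ ℕ (Least P n)) ⊎ (∀ m → m ≤ n → ¬ P m)
least-upto P P? zero with P? zero
... | yes p = inj₁ (zero , p , (λ _ _ → z≤n) , z≤n)
... | no ¬p = inj₂ λ { zero z≤n → ¬p }
least-upto P P? (suc n) with least-upto P P? n
... | inj₁ (N , p , least , N≤n) = inj₁ (N , p , least , m≤n⇒m≤1+n N≤n)
... | inj₂ none with P? (suc n)
...   | yes p = inj₁ (suc n , p , (λ N′ p′ → ≰⇒> λ N′≤n → none N′ N′≤n p′) , ≤-refl)
...   | no ¬p = inj₂ λ m m≤1+n → below (m≤n⇒m<n∨m≡n m≤1+n)
  where
  below : ∀ {m} → m < suc n ⊎ m ≡ suc n → ¬ P m
  below (inj₁ (s≤s m≤n)) = none _ m≤n
  below (inj₂ refl) = ¬p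

ramsey-number-below : (G H : OrderedGraph) → (∀ i j → Dec (adj G i j)) → (∀ i j → Dec (adj H i j)) →
  ∀ N → Arrows G H N → Σ ℕ λ R → IsOrdRamsey G H R × R ≤ N
ramsey-number-below G H G? H? N arrows with least-upto (Arrows G H) (arrows? G H G? H?) N
... | inj₁ (R , arrowsR , least , R≤N) = R , (arrowsR , least) , R≤N
... | inj₂ none = ⊥-elim (none N ≤-refl arrows)

copy-along : ∀ {G n N col} (c : Colouring N) (e : Fin n → Fin N) → (∀ u v → u <ᶠ v → e u <ᶠ e v) →
  CopyOf G (λ u v → c (e u) (e v)) col → CopyOf G c col
copy-along c e e-increasing (f , f-increasing , edges) =
  (λ i → e (f i)) , (λ i j i<j → e-increasing _ _ (f-increasing i j i<j)) , edges

join : ℕ → (ℕ → ℕ) → (ℕ → ℕ) → ℕ → ℕ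
join n f g a with a <? n
... | yes _ = f a
... | no _ = g (a ∸ n)

join-left : ∀ {n f g a} → a < n → join n f g a ≡ f a
join-left {n} {a = a} a<n with a <? n
... | yes _ = refl
... | no a≮n = ⊥-elim (a≮n a<n)

join-right : ∀ {n f g a} → n ≤ a → join n f g a ≡ g (a ∸ n)
join-right {n} {a = a} n≤a with a <? n
... | yes a<n = ⊥-elim (<⇒≱ a<n n≤a)
... | no _ = refl

shifted-position : ∀ n a m → n ≤ a → a < n + m → a ∸ n < m
shifted-position zero a m _ a< = a<
shifted-position (suc n) (suc a) m (s≤s n≤a) (s≤s a<) = shifted-position n a m n≤a a<

framed-position : ∀ n a → suc a < suc (n + 1) → a < n ⊎ a ≡ n
framed-position n a (s≤s a<) = m≤n⇒m<n∨m≡n (≤-pred (subst (suc a ≤_) (+-comm n 1) a<))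

window : ∀ {N} lo {r} → lo + r ≤ N → Fin r → Fin N
window lo fits u = fromℕ< (<-≤-trans (+-monoʳ-< lo (Fin.toℕ<n u)) fits)

toℕ-window : ∀ {N} lo {r} (fits : lo + r ≤ N) u → toℕ (window lo fits u) ≡ lo + toℕ u
toℕ-window lo fits u = Fin.toℕ-fromℕ< _

window-increasing : ∀ {N} lo {r} (fits : lo + r ≤ N) u v → u <ᶠ v → window lo fits u <ᶠ window lo fits v
window-increasing lo fits u v u<v =
  subst₂ _<_ (sym (toℕ-window lo fits u)) (sym (toℕ-window lo fits v)) (+-monoʳ-< lo u<v)

module Embedding {N : ℕ} (c : Colouring N) where

  -- The colouring read on natural numbers; pairs outside [0, N) are never consulted.
  colourAt : ℕ → ℕ → Colour
  colourAt x y with x <? N | y <? N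
  ... | yes x<N | yes y<N = c (fromℕ< x<N) (fromℕ< y<N)
  ... | _ | _ = red

  colourAt-inside : ∀ {x y} (x<N : x < N) (y<N : y < N) → colourAt x y ≡ c (fromℕ< x<N) (fromℕ< y<N)
  colourAt-inside {x} {y} x<N y<N with x <? N | y <? N
  ... | yes _ | yes _ = refl
  ... | no x≮N | _ = ⊥-elim (x≮N x<N)
  ... | yes _ | no y≮N = ⊥-elim (y≮N y<N)

  colourAt-toℕ : ∀ u v → colourAt (toℕ u) (toℕ v) ≡ c u v
  colourAt-toℕ u v = trans (colourAt-inside (Fin.toℕ<n u) (Fin.toℕ<n v))
    (cong₂ c (Fin.fromℕ<-toℕ u _) (Fin.fromℕ<-toℕ v _))

  record RedEmbedding (s : List Paren) (lo hi : ℕ) : Set where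
    field
      pos        : ℕ → ℕ
      in-range   : ∀ a → a < length s → lo ≤ pos a × pos a < hi
      increasing : ∀ a b → a < b → b < length s → pos a < pos b
      red-pairs  : ∀ a b → Matched s a b → colourAt (pos a) (pos b) ≡ red
  open RedEmbedding

  Outcome : List Paren → ℕ → ℕ → Set
  Outcome s lo hi = RedEmbedding s lo hi ⊎ CopyOf K3 c blue

  outcome-widen : ∀ {s lo hi lo′ hi′} → lo′ ≤ lo → hi ≤ hi′ → Outcome s lo hi → Outcome s lo′ hi′
  outcome-widen lo′≤lo hi≤hi′ (inj₁ E) = inj₁ record
    { pos = pos E
    ; in-range = λ a a< → ≤-trans lo′≤lo (proj₁ (in-range E a a<)) , <-≤-trans (proj₂ (in-range E a a<)) hi≤hi′
    ; increasing = increasing E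
    ; red-pairs = red-pairs E }
  outcome-widen _ _ (inj₂ blue-triangle) = inj₂ blue-triangle

  embedding-++ : ∀ {X Y lo mid hi} → Balanced X → lo ≤ mid → mid ≤ hi →
    RedEmbedding X lo mid → RedEmbedding Y mid hi → RedEmbedding (X ++ Y) lo hi
  embedding-++ {X} {Y} {lo} {mid} {hi} bX lo≤mid mid≤hi EX EY = record
    { pos = p ; in-range = p-range ; increasing = p-increasing ; red-pairs = p-red }
    where
    n = length X
    p = join n (pos EX) (pos EY)
    in-Y : ∀ {a} → n ≤ a → a < length (X ++ Y) → a ∸ n < length Y
    in-Y {a} n≤a a< = shifted-position n a _ n≤a (subst (a <_) (length-++ X) a<)
    p-range : ∀ a → a < length (X ++ Y) → lo ≤ p a × p a < hi
    p-range a a< with a <? n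
    ... | yes a<n = proj₁ (in-range EX a a<n) , <-≤-trans (proj₂ (in-range EX a a<n)) mid≤hi
    ... | no a≮n = ≤-trans lo≤mid (proj₁ (in-range EY _ Y-pos)) , proj₂ (in-range EY _ Y-pos)
      where Y-pos = in-Y (≮⇒≥ a≮n) a<
    p-increasing : ∀ a b → a < b → b < length (X ++ Y) → p a < p b
    p-increasing a b a<b b< with a <? n | b <? n
    ... | yes a<n | yes b<n = increasing EX a b a<b b<n
    ... | yes a<n | no b≮n =
      <-≤-trans (proj₂ (in-range EX a a<n)) (proj₁ (in-range EY _ (in-Y (≮⇒≥ b≮n) b<)))
    ... | no a≮n | yes b<n = ⊥-elim (a≮n (<-trans a<b b<n))
    ... | no a≮n | no b≮n =
      increasing EY _ _ (∸-monoˡ-< a<b (≮⇒≥ a≮n)) (in-Y (≮⇒≥ b≮n) b<)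
    p-red : ∀ a b → Matched (X ++ Y) a b → colourAt (p a) (p b) ≡ red
    p-red a b m with matched-++ bX Y a b m
    ... | inj₁ mX = subst₂ (λ u v → colourAt u v ≡ red)
      (sym (join-left (<-trans a<b b<n))) (sym (join-left b<n)) (red-pairs EX a b mX)
      where
      a<b = proj₁ (matched-bounds X a b mX)
      b<n = proj₂ (matched-bounds X a b mX)
    ... | inj₂ (n≤a , mY) = subst₂ (λ u v → colourAt u v ≡ red)
      (sym (join-right n≤a)) (sym (join-right (≤-trans n≤a (<⇒≤ (proj₁ (matched-bounds _ a b m))))))
      (red-pairs EY _ _ mY)

  outcome-++ : ∀ {X Y lo mid hi} → Balanced X → lo ≤ mid → mid ≤ hi →
    Outcome X lo mid → Outcome Y mid hi → Outcome (X ++ Y) lo hi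
  outcome-++ bX lo≤mid mid≤hi (inj₁ EX) (inj₁ EY) = inj₁ (embedding-++ bX lo≤mid mid≤hi EX EY)
  outcome-++ _ _ _ (inj₁ _) (inj₂ blue-triangle) = inj₂ blue-triangle
  outcome-++ _ _ _ (inj₂ blue-triangle) _ = inj₂ blue-triangle

  embedding-wrap : ∀ {X lo hi x y} → Balanced X → x < lo → hi ≤ y → x < y → colourAt x y ≡ red →
    RedEmbedding X lo hi → RedEmbedding (op ∷ X ++ cl ∷ []) x (suc y)
  embedding-wrap {X} {lo} {hi} {x} {y} bX x<lo hi≤y x<y xy-red E = record
    { pos = p ; in-range = p-range ; increasing = p-increasing ; red-pairs = p-red }
    where
    n = length X
    p : ℕ → ℕ
    p zero = x
    p (suc a) = join n (pos E) (λ _ → y) a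
    p-inner : ∀ {a} → a < n → p (suc a) ≡ pos E a
    p-inner = join-left
    p-last : p (suc n) ≡ y
    p-last = join-right (≤-refl {n})
    position : ∀ {a} → suc a < length (op ∷ X ++ cl ∷ []) → a < n ⊎ a ≡ n
    position {a} a< = framed-position n a (subst (suc a <_) (cong suc (length-++ X)) a<)
    p-range : ∀ a → a < length (op ∷ X ++ cl ∷ []) → x ≤ p a × p a < suc y
    p-range zero _ = ≤-refl , s≤s (<⇒≤ x<y)
    p-range (suc a) a< with position a<
    ... | inj₁ a<n rewrite p-inner a<n =
      ≤-trans (<⇒≤ x<lo) (proj₁ (in-range E a a<n)) , <-≤-trans (proj₂ (in-range E a a<n)) (m≤n⇒m≤1+n hi≤y)
    ... | inj₂ refl rewrite p-last = <⇒≤ x<y , ≤-refl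
    p-increasing : ∀ a b → a < b → b < length (op ∷ X ++ cl ∷ []) → p a < p b
    p-increasing zero (suc b) _ b< with position b<
    ... | inj₁ b<n rewrite p-inner b<n = <-≤-trans x<lo (proj₁ (in-range E b b<n))
    ... | inj₂ refl rewrite p-last = x<y
    p-increasing (suc a) (suc b) (s≤s a<b) b< with position b<
    ... | inj₁ b<n rewrite p-inner b<n | p-inner (<-trans a<b b<n) = increasing E a b a<b b<n
    ... | inj₂ refl rewrite p-last | p-inner a<b = <-≤-trans (proj₂ (in-range E a a<b)) hi≤y
    p-red : ∀ a b → Matched (op ∷ X ++ cl ∷ []) a b → colourAt (p a) (p b) ≡ red
    p-red a b m with matched-wrap bX a b m
    ... | inj₁ (refl , refl) rewrite p-last = xy-red
    ... | inj₂ (a′ , b′ , refl , refl , mX)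
      rewrite p-inner (proj₂ (matched-bounds X a′ b′ mX))
            | p-inner (<-trans (proj₁ (matched-bounds X a′ b′ mX)) (proj₂ (matched-bounds X a′ b′ mX))) =
      red-pairs E a′ b′ mX

  outcome-wrap : ∀ {X lo hi x y} → Balanced X → x < lo → hi ≤ y → x < y → colourAt x y ≡ red →
    Outcome X lo hi → Outcome (op ∷ X ++ cl ∷ []) x (suc y)
  outcome-wrap bX x<lo hi≤y x<y xy-red (inj₁ E) = inj₁ (embedding-wrap bX x<lo hi≤y x<y xy-red E)
  outcome-wrap _ _ _ _ _ (inj₂ blue-triangle) = inj₂ blue-triangle

  positions : ∀ {n} → (Fin n → Fin N) → ℕ → ℕ
  positions {n} f a with a <? n
  ... | yes a<n = toℕ (f (fromℕ< a<n))
  ... | no _ = 0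

  positions-inside : ∀ {n} (f : Fin n → Fin N) {a} (a<n : a < n) → positions f a ≡ toℕ (f (fromℕ< a<n))
  positions-inside {n} f {a} a<n with a <? n
  ... | yes _ = refl
  ... | no a≮n = ⊥-elim (a≮n a<n)

  copy⇒embedding : ∀ s {lo hi} ((f , _) : CopyOf (inducedMatching s) c red) →
    (∀ i → lo ≤ toℕ (f i) × toℕ (f i) < hi) → RedEmbedding s lo hi
  copy⇒embedding s {lo} {hi} (f , f-increasing , edges) f-range = record
    { pos = positions f ; in-range = p-range ; increasing = p-increasing ; red-pairs = p-red }
    where
    vertex : ∀ {a} → a < length s → Fin (length s)
    vertex a< = fromℕ< a<
    toℕ-vertex : ∀ {a} (a< : a < length s) → toℕ (vertex a<) ≡ a
    toℕ-vertex a< = Fin.toℕ-fromℕ< a<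
    p-range : ∀ a → a < length s → lo ≤ positions f a × positions f a < hi
    p-range a a< rewrite positions-inside f a< = f-range (vertex a<)
    p-increasing : ∀ a b → a < b → b < length s → positions f a < positions f b
    p-increasing a b a<b b< rewrite positions-inside f (<-trans a<b b<) | positions-inside f b< =
      f-increasing _ _ (subst₂ _<_ (sym (toℕ-vertex (<-trans a<b b<))) (sym (toℕ-vertex b<)) a<b)
    p-red : ∀ a b → Matched s a b → colourAt (positions f a) (positions f b) ≡ red
    p-red a b m =
      trans (cong₂ colourAt (positions-inside f a<) (positions-inside f b<)) (trans (colourAt-toℕ _ _)
        (edges _ _ (subst₂ _<_ (sym (toℕ-vertex a<)) (sym (toℕ-vertex b<)) a<b)
               (inj₁ (subst₂ (Matched s) (sym (toℕ-vertex a<)) (sym (toℕ-vertex b<)) m))))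
      where
      a<b = proj₁ (matched-bounds s a b m)
      b< = proj₂ (matched-bounds s a b m)
      a< = <-trans a<b b<

  embedding⇒copy : ∀ {s} → RedEmbedding s 0 N → CopyOf (inducedMatching s) c red
  embedding⇒copy {s} E = F , F-increasing , F-red
    where
    inside : ∀ (i : Fin (length s)) → pos E (toℕ i) < N
    inside i = proj₂ (in-range E (toℕ i) (Fin.toℕ<n i))
    F : Fin (length s) → Fin N
    F i = fromℕ< (inside i)
    F-increasing : ∀ i j → i <ᶠ j → F i <ᶠ F j
    F-increasing i j i<j = subst₂ _<_ (sym (Fin.toℕ-fromℕ< (inside i))) (sym (Fin.toℕ-fromℕ< (inside j)))
      (increasing E _ _ i<j (Fin.toℕ<n j))
    F-red : ∀ i j → i <ᶠ j → adj (inducedMatching s) i j → c (F i) (F j) ≡ red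
    F-red i j _ (inj₁ m) = trans (sym (colourAt-inside (inside i) (inside j))) (red-pairs E _ _ m)
    F-red i j i<j (inj₂ m) = ⊥-elim (<-asym i<j (proj₁ (matched-bounds s _ _ m)))

  outcome-block : ∀ X lo r {hi} → lo + r ≤ hi → hi ≤ N →
    Arrows (inducedMatching X) K3 r → Outcome X lo hi
  outcome-block X lo r {hi} lo+r≤hi hi≤N arrows = from-window (arrows (λ u v → c (w u) (w v)))
    where
    fits = ≤-trans lo+r≤hi hi≤N
    w = window lo fits
    from-window : CopyOf (inducedMatching X) (λ u v → c (w u) (w v)) red ⊎ CopyOf K3 (λ u v → c (w u) (w v)) blue →
      Outcome X lo hi
    from-window (inj₂ blue-triangle) = inj₂ (copy-along c w (window-increasing lo fits) blue-triangle)
    from-window (inj₁ red-copy@(f , _)) =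
      inj₁ (copy⇒embedding X (copy-along c w (window-increasing lo fits) red-copy) λ i →
        subst (λ z → lo ≤ z × z < hi) (sym (toℕ-window lo fits (f i)))
          (m≤m+n lo _ , <-≤-trans (+-monoʳ-< lo (Fin.toℕ<n (f i))) lo+r≤hi))

-- The pair (lo, q + w) is symmetric in [0, 2q) exactly when lo + w + 1 = q.
symmetric-pair-sum : ∀ lo w q → suc lo + suc (q + w) ≡ (lo + suc w) + q + 1
symmetric-pair-sum = solve-∀

double-plus-one : ∀ q → q + q + 1 ≡ 2 * q + 1
double-plus-one = solve-∀

regroup : ∀ (X Y Z : List Paren) → op ∷ X ++ Y ++ Z ++ cl ∷ [] ≡ op ∷ (X ++ Y ++ Z) ++ cl ∷ []
regroup X Y Z = cong (op ∷_) (sym (trans (++-assoc X (Y ++ Z) (cl ∷ [])) (cong (X ++_) (++-assoc Y Z (cl ∷ [])))))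

unfold-level : ∀ a b c → suc (a + (suc b + c)) ≡ suc (suc b) + (a + c)
unfold-level = solve-∀

applyUpTo-cong : ∀ {B : Set} {f g : ℕ → B} → (∀ i → f i ≡ g i) → ∀ n → applyUpTo f n ≡ applyUpTo g n
applyUpTo-cong {f = f} {g} f≗g n = trans (sym (map-upTo f n)) (trans (map-cong f≗g (upTo n)) (map-upTo g n))

index-bounds : ∀ {j k} → 1 ≤ j → j ≤ k →
  (j ≤ 2 * k ∸ 1) × (1 ≤ 2 * k ∸ j) × (2 * k ∸ j ≤ 2 * k ∸ 1)
index-bounds {suc _} {zero} _ ()
index-bounds {j} {suc k′} 1≤j j≤k = j≤ , m<n⇒0<n∸m (s≤s j≤) , ∸-monoʳ-≤ (2 * suc k′) 1≤j
  where
  j≤ : j ≤ k′ + suc (k′ + 0)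
  j≤ = ≤-trans j≤k (subst (suc k′ ≤_) (sym (+-suc k′ (k′ + 0))) (s≤s (m≤m+n k′ (k′ + 0))))

module Nesting (k : ℕ) (A : ℕ → List Paren)
  (balanced : ∀ i → 1 ≤ i → i ≤ 2 * k ∸ 1 → Balanced (A i))
  (r : ℕ → ℕ)
  (arrows : ∀ i → 1 ≤ i → i ≤ 2 * k ∸ 1 → Arrows (inducedMatching (A i)) K3 (r i))
  where
  -- The data of the theorem; of the Ramsey numbers r i only the arrowing property is used.

  j≤k : ∀ {j m} → j + m ≡ k → j ≤ k
  j≤k {j} {m} e = subst (j ≤_) e (m≤m+n j m)

  nest-balanced : ∀ m j → 1 ≤ j → j + m ≡ k → Balanced (nestAux k A m j)
  nest-balanced zero j 1≤j e = bal-wrap (balanced j 1≤j (proj₁ (index-bounds 1≤j (j≤k e)))) bal-[]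
  nest-balanced (suc m) j 1≤j e = subst Balanced (sym (regroup (A j) _ (A (2 * k ∸ j))))
    (bal-wrap (balanced-++ (balanced j 1≤j left)
      (balanced-++ (nest-balanced m (suc j) (s≤s z≤n) (trans (sym (+-suc j m)) e))
                   (balanced _ (proj₁ mirror) (proj₂ mirror)))) bal-[])
    where
    left = proj₁ (index-bounds 1≤j (j≤k e))
    mirror = proj₂ (index-bounds 1≤j (j≤k e))

  -- Room reserved on each side at level j: enough for both A j and its mirror A (2k - j).
  blockSize : ℕ → ℕ
  blockSize j = r j ⊔ r (2 * k ∸ j)

  -- Half the width of the window occupied by the levels j, …, j + m.
  halfWidth : ℕ → ℕ → ℕ
  halfWidth zero j = suc (blockSize j)
  halfWidth (suc m) j = suc (blockSize j + halfWidth m (suc j))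

  halfWidth-sum : ∀ m j → halfWidth m j ≡ suc m + sum (applyUpTo (λ i → blockSize (i + j)) (suc m))
  halfWidth-sum zero j = cong suc (sym (+-identityʳ (blockSize j)))
  halfWidth-sum (suc m) j = begin
    suc (blockSize j + halfWidth m (suc j))
      ≡⟨ cong (λ w → suc (blockSize j + w)) (halfWidth-sum m (suc j)) ⟩
    suc (blockSize j + (suc m + sum (applyUpTo (λ i → blockSize (i + suc j)) (suc m))))
      ≡⟨ cong (λ l → suc (blockSize j + (suc m + sum l)))
              (applyUpTo-cong (λ i → cong blockSize (+-suc i j)) (suc m)) ⟩
    suc (blockSize j + (suc m + sum (applyUpTo (λ i → blockSize (suc i + j)) (suc m))))
      ≡⟨ unfold-level (blockSize j) m _ ⟩
    suc (suc m) + sum (applyUpTo (λ i → blockSize (i + j)) (suc (suc m))) ∎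
    where open ≡-Reasoning

  total-width : 1 ≤ k → halfWidth (k ∸ 1) 1 ≡ k + tSum k r
  total-width 1≤k = begin
    halfWidth (k ∸ 1) 1
      ≡⟨ halfWidth-sum (k ∸ 1) 1 ⟩
    suc (k ∸ 1) + sum (applyUpTo (λ i → blockSize (i + 1)) (suc (k ∸ 1)))
      ≡⟨ cong (λ n → n + sum (applyUpTo (λ i → blockSize (i + 1)) n)) (m+[n∸m]≡n 1≤k) ⟩
    k + sum (applyUpTo (λ i → blockSize (i + 1)) k)
      ≡⟨ cong (λ l → k + sum l) (applyUpTo-cong (λ i → cong blockSize (+-comm i 1)) k) ⟩
    k + sum (applyUpTo (λ i → blockSize (suc i)) k)
      ≡⟨ cong (λ l → k + sum l) (map-upTo _ k) ⟨
    k + tSum k r ∎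
    where open ≡-Reasoning

  module Construction (q : ℕ) (c : Colouring (2 * q))
    (nm-red : ∀ u v → u <ᶠ v → adj (NM q) u v → c u v ≡ red) where
    open Embedding c public

    q≤2q : q ≤ 2 * q
    q≤2q = m≤m+n q (q + 0)

    symmetric-pair : ∀ lo w → lo + suc w ≡ q →
      (lo < q + w) × (q + w < 2 * q) × (colourAt lo (q + w) ≡ red)
    symmetric-pair lo w eq = lo<y , y<2q , trans (colourAt-inside lo<2q y<2q) (nm-red _ _ ordered adjacent)
      where
      lo<q : lo < q
      lo<q = subst (lo <_) eq (m<m+n lo (s≤s z≤n))
      w<q : w < q
      w<q = subst (w <_) eq (m≤n+m (suc w) lo)
      lo<y : lo < q + w
      lo<y = <-≤-trans lo<q (m≤m+n q w)
      y<2q : q + w < 2 * q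
      y<2q = subst (q + w <_) (cong (q +_) (sym (+-identityʳ q))) (+-monoʳ-< q w<q)
      lo<2q = <-trans lo<y y<2q
      ordered : fromℕ< lo<2q <ᶠ fromℕ< y<2q
      ordered = subst₂ _<_ (sym (Fin.toℕ-fromℕ< lo<2q)) (sym (Fin.toℕ-fromℕ< y<2q)) lo<y
      adjacent : suc (toℕ (fromℕ< lo<2q)) + suc (toℕ (fromℕ< y<2q)) ≡ 2 * q + 1
      adjacent rewrite Fin.toℕ-fromℕ< lo<2q | Fin.toℕ-fromℕ< y<2q = begin
        suc lo + suc (q + w)   ≡⟨ symmetric-pair-sum lo w q ⟩
        lo + suc w + q + 1     ≡⟨ cong (λ z → z + q + 1) eq ⟩
        q + q + 1              ≡⟨ double-plus-one q ⟩
        2 * q + 1              ∎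
        where open ≡-Reasoning

    -- Levels j, …, j + m nest into the window [lo, q + halfWidth m j) centred at q:
    -- level j sits on the red pair (lo, q + halfWidth m j - 1) with A j right after lo,
    -- its mirror right before the closing vertex, and the deeper levels in between.
    nest : ∀ m j lo → 1 ≤ j → j + m ≡ k → lo + halfWidth m j ≡ q →
      Outcome (nestAux k A m j) lo (q + halfWidth m j)
    nest zero j lo 1≤j e eq =
      outcome-widen ≤-refl (≤-reflexive (sym (+-suc q S)))
        (outcome-wrap (balanced j 1≤j left) ≤-refl (m≤m+n q S) lo<y y-red
          (outcome-block (A j) (suc lo) (r j) A-fits q≤2q (arrows j 1≤j left)))
      where
      S = blockSize j
      left = proj₁ (index-bounds 1≤j (j≤k e))
      pair = symmetric-pair lo S eq
      lo<y = proj₁ pair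
      y-red = proj₂ (proj₂ pair)
      A-fits : suc lo + r j ≤ q
      A-fits = ≤-trans (+-monoʳ-≤ (suc lo) (m≤m⊔n (r j) _)) (≤-reflexive (trans (sym (+-suc lo S)) eq))
    nest (suc m) j lo 1≤j e eq =
      subst (λ Z → Outcome Z lo (q + halfWidth (suc m) j)) (sym (regroup (A j) _ (A j′)))
        (outcome-widen ≤-refl (≤-reflexive (sym (+-suc q (S + w))))
          (outcome-wrap (balanced-++ bA (balanced-++ bN bA′)) ≤-refl (≤-reflexive right-end) lo<y y-red
            (outcome-++ bA (m≤m+n (suc lo) S) (≤-trans lo′≤q (≤-trans (m≤m+n q w) (m≤m+n (q + w) S)))
              (outcome-block (A j) (suc lo) (r j) (+-monoʳ-≤ (suc lo) (m≤m⊔n (r j) _)) lo′≤2q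
                (arrows j 1≤j left))
              (outcome-++ bN (≤-trans lo′≤q (m≤m+n q w)) (m≤m+n (q + w) S)
                (nest m (suc j) lo′ (s≤s z≤n) e′ eq′)
                (outcome-block (A j′) (q + w) (r j′) (+-monoʳ-≤ (q + w) (m≤n⊔m (r j) _))
                  (≤-trans (≤-reflexive right-end) (<⇒≤ y<2q)) (arrows j′ (proj₁ mirror) (proj₂ mirror)))))))
      where
      S = blockSize j
      w = halfWidth m (suc j)
      j′ = 2 * k ∸ j
      lo′ = suc lo + S
      left = proj₁ (index-bounds 1≤j (j≤k e))
      mirror = proj₂ (index-bounds 1≤j (j≤k e))
      e′ : suc j + m ≡ k
      e′ = trans (sym (+-suc j m)) e
      bA = balanced j 1≤j left
      bA′ = balanced j′ (proj₁ mirror) (proj₂ mirror)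
      bN = nest-balanced m (suc j) (s≤s z≤n) e′
      eq′ : lo′ + w ≡ q
      eq′ = trans (cong suc (+-assoc lo S w)) (trans (sym (+-suc lo (S + w))) eq)
      lo′≤q : lo′ ≤ q
      lo′≤q = subst (lo′ ≤_) eq′ (m≤m+n lo′ w)
      lo′≤2q = ≤-trans lo′≤q q≤2q
      right-end : q + w + S ≡ q + (S + w)
      right-end = trans (+-assoc q w S) (cong (q +_) (+-comm w S))
      pair = symmetric-pair lo (S + w) eq
      lo<y = proj₁ pair
      y<2q = proj₁ (proj₂ pair)
      y-red = proj₂ (proj₂ pair)

  -- If k ≥ 1 and R arrows (NM (k + t) , K₃), then R arrows (matching of the nesting , K₃):
  -- pull a colouring back along a red copy of NM (k + t) and run the construction there.
  nested-arrows : 1 ≤ k → ∀ R → Arrows (NM (k + tSum k r)) K3 R →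
    Arrows (inducedMatching (nested k A)) K3 R
  nested-arrows 1≤k R nm-arrows c with nm-arrows c
  ... | inj₂ blue-triangle = inj₂ blue-triangle
  ... | inj₁ (g , g-increasing , g-red) =
    from-outcome (outcome-widen ≤-refl fits (nest (k ∸ 1) 1 0 ≤-refl (m+[n∸m]≡n 1≤k) (total-width 1≤k)))
    where
    q = k + tSum k r
    open Construction q (λ u v → c (g u) (g v)) g-red
    fits : q + halfWidth (k ∸ 1) 1 ≤ 2 * q
    fits = ≤-reflexive (cong₂ _+_ refl (trans (total-width 1≤k) (sym (+-identityʳ q))))
    from-outcome : Outcome (nested k A) 0 (2 * q) →
      CopyOf (inducedMatching (nested k A)) c red ⊎ CopyOf K3 c blue
    from-outcome (inj₁ E) = inj₁ (copy-along c g g-increasing (embedding⇒copy E))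
    from-outcome (inj₂ blue-triangle) = inj₂ (copy-along c g g-increasing blue-triangle)

lemma4 : (k : ℕ) → 1 ≤ k → (A : ℕ → List Paren) →
    (∀ i → 1 ≤ i → i ≤ 2 * k ∸ 1 → Balanced (A i)) →
    (r : ℕ → ℕ) →
    (∀ i → 1 ≤ i → i ≤ 2 * k ∸ 1 → IsOrdRamsey (inducedMatching (A i)) K3 (r i)) →
    (R : ℕ) → IsOrdRamsey (NM (k + tSum k r)) K3 R →
    Balanced (nested k A) ×
    Σ ℕ (λ rM → IsOrdRamsey (inducedMatching (nested k A)) K3 rM × rM ≤ R)
lemma4 k 1≤k A balancedA r ramseyA R ramseyNM =
  nest-balanced (k ∸ 1) 1 ≤-refl (m+[n∸m]≡n 1≤k) ,
  ramsey-number-below (inducedMatching (nested k A)) K3 (matching-adj? (nested k A)) K3-adj? R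
    (nested-arrows 1≤k R (proj₁ ramseyNM))
  where open Nesting k A balancedA r (λ i 1≤i i≤ → proj₁ (ramseyA i 1≤i i≤))
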